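{- Let $S$ be a Foulis semigroup, viewed as a one-object dagger category. Its dagger Karoubi envelope $\mathrm{Kar}^\dagger(S)$ is a dagger kernel category; explicitly, the dagger kernel of $f\colon s\to t$ is $s\cdot[f]\colon (s\cdot[f])\to s$. Moreover, the mapping $S\mapsto\mathrm{Kar}^\dagger(S)$, sending a Foulis semigroup morphism $h\colon S\to T$ to the functor $s\mapsto h(s)$, $f\mapsto h(f)$, is a functor $\mathbf{Fsg}\to\mathbf{DKC}$.
   Context: A Foulis semigroup is a monoid $(S,\cdot,1)$ with maps $(-)^\dagger\colon S\to S$ and $[-]\colon S\to S$ such that: (1) $1^\dagger=1$, $(s\cdot t)^\dagger=t^\dagger\cdot s^\dagger$, $s^{\dagger\dagger}=s$; (2) $[s]\cdot[s]=[s]=[s]^\dagger$; (3) $0:=[1]$ satisfies $0\cdot s=0=s\cdot0$; (4) $s\cdot x=0$ iff there is $y$ with $x=[s]\cdot y$. $\mathbf{Fsg}$ is the category of Foulis semigroups with monoid homomorphisms commuting with $\dagger$ and $[-]$. $\mathrm{Kar}^\dagger(S)$ has as objects the self-adjoint idempotents $s\in S$ ($s^\dagger=s=s\cdot s$), as morphisms $f\colon s\to t$ the elements $f\in S$ with $f\cdot s=f=t\cdot f$, identity on $s$ equal to $s$, composition the multiplication of $S$, dagger $f\mapsto f^\dagger$. A dagger kernel category is a category with an identity-on-objects functor $\dagger\colon\mathbf{D}^{\mathrm{op}}\to\mathbf{D}$ with $f^{\dagger\dagger}=f$, a zero object, and for every morphism a kernel that is a dagger mono ($k^\dagger k=\mathrm{id}$).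 $\mathbf{DKC}$ is the category of dagger kernel categories with functors preserving dagger, zero object and kernels. -}

module Defs where

open import Level using (Level; _⊔_; suc)
open import Data.Product using (Σ; _×_; _,_; proj₁; proj₂)
open import Relation.Binary.PropositionalEquality
  using (_≡_; refl; sym; trans; cong; cong₂)
open import Relation.Binary.Structures using (IsEquivalence)
open import Algebra.Structures using (IsMonoid)

record FoulisSemigroup (c : Level) : Set (suc c) where
  infixl 7 _·_
  infix  8 _†
  field
    Carrier  : Set c
    _·_      : Carrier → Carrier → Carrier
    ε        : Carrier
    _†       : Carrier → Carrier
    [_]      : Carrier → Carrier
    isMonoid : IsMonoid _≡_ _·_ ε
    †-unit   : ε † ≡ ε
    †-anti   : ∀ s t → (s · t) † ≡ t † · s †
    †-invol  : ∀ s → s † † ≡ s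
    []-idem  : ∀ s → [ s ] · [ s ] ≡ [ s ]
    []-sa    : ∀ s → [ s ] ≡ [ s ] †
  𝟘 : Carrier
  𝟘 = [ ε ]
  field
    zeroˡ    : ∀ s → 𝟘 · s ≡ 𝟘
    zeroʳ    : ∀ s → s · 𝟘 ≡ 𝟘
    foulis⇒  : ∀ s x → s · x ≡ 𝟘 → Σ Carrier (λ y → x ≡ [ s ] · y)
    foulis⇐  : ∀ s x → Σ Carrier (λ y → x ≡ [ s ] · y) → s · x ≡ 𝟘

  open IsMonoid isMonoid public using (assoc; identityˡ; identityʳ)

  IsSAI : Carrier → Set c
  IsSAI s = (s † ≡ s) × (s · s ≡ s)

record FsgHom {c} (S T : FoulisSemigroup c) : Set c where
  private
    module S = FoulisSemigroup S
    module T = FoulisSemigroup T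
  field
    fun   : S.Carrier → T.Carrier
    hom-· : ∀ x y → fun (x S.· y) ≡ fun x T.· fun y
    hom-ε : fun S.ε ≡ T.ε
    hom-† : ∀ x → fun (x S.†) ≡ (fun x) T.†
    hom-[] : ∀ x → fun (S.[ x ]) ≡ T.[ fun x ]

idFsg : ∀ {c} (S : FoulisSemigroup c) → FsgHom S S
idFsg S = record
  { fun = λ x → x ; hom-· = λ _ _ → refl ; hom-ε = refl
  ; hom-† = λ _ → refl ; hom-[] = λ _ → refl }

_∘Fsg_ : ∀ {c} {S T U : FoulisSemigroup c} → FsgHom T U → FsgHom S T → FsgHom S U
_∘Fsg_ {S = S} {T} {U} g h = record
  { fun = λ x → G (H x)
  ; hom-· = λ x y → trans (cong G (FsgHom.hom-· h x y)) (FsgHom.hom-· g (H x) (H y))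
  ; hom-ε = trans (cong G (FsgHom.hom-ε h)) (FsgHom.hom-ε g)
  ; hom-† = λ x → trans (cong G (FsgHom.hom-† h x)) (FsgHom.hom-† g (H x))
  ; hom-[] = λ x → trans (cong G (FsgHom.hom-[] h x)) (FsgHom.hom-[] g (H x)) }
  where
  G = FsgHom.fun g
  H = FsgHom.fun h

record DagCatData (o ℓ e : Level) : Set (suc (o ⊔ ℓ ⊔ e)) where
  infixr 9 _∘_
  field
    Obj  : Set o
    Hom  : Obj → Obj → Set ℓ
    _≈_  : ∀ {A B} → Hom A B → Hom A B → Set e
    id   : ∀ {A} → Hom A A
    _∘_  : ∀ {A B C} → Hom B C → Hom A B → Hom A C
    _†   : ∀ {A B} → Hom A B → Hom B A

module _ {o ℓ e} (D : DagCatData o ℓ e) where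
  open DagCatData D

  record IsDaggerCategory : Set (o ⊔ ℓ ⊔ e) where
    field
      isEquiv  : ∀ {A B} → IsEquivalence (_≈_ {A} {B})
      ∘-resp-≈ : ∀ {A B C} {f f' : Hom A B} {g g' : Hom B C} →
                 g ≈ g' → f ≈ f' → (g ∘ f) ≈ (g' ∘ f')
      assoc    : ∀ {A B C D'} (f : Hom A B) (g : Hom B C) (h : Hom C D') →
                 ((h ∘ g) ∘ f) ≈ (h ∘ (g ∘ f))
      identityˡ : ∀ {A B} (f : Hom A B) → (id ∘ f) ≈ f
      identityʳ : ∀ {A B} (f : Hom A B) → (f ∘ id) ≈ f
      †-resp-≈ : ∀ {A B} {f f' : Hom A B} → f ≈ f' → (f †) ≈ (f' †)
      †-id     : ∀ {A} → ((id {A}) †) ≈ id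
      †-∘      : ∀ {A B C} (f : Hom A B) (g : Hom B C) → ((g ∘ f) †) ≈ ((f †) ∘ (g †))
      †-invol  : ∀ {A B} (f : Hom A B) → ((f †) †) ≈ f

  IsZeroObject : Obj → Set (o ⊔ ℓ ⊔ e)
  IsZeroObject Z = ∀ A → Σ (Hom A Z) (λ f → ∀ g → g ≈ f)
                       × Σ (Hom Z A) (λ f → ∀ g → g ≈ f)

  zeroMor : ∀ {Z} → IsZeroObject Z → ∀ {X Y} → Hom X Y
  zeroMor isZ {X} {Y} = proj₁ (proj₂ (isZ Y)) ∘ proj₁ (proj₁ (isZ X))

  IsKernel : ∀ {Z} → IsZeroObject Z → ∀ {A B K} → Hom A B → Hom K A → Set (o ⊔ ℓ ⊔ e)
  IsKernel isZ {A} {B} {K} f k =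
    ((f ∘ k) ≈ zeroMor isZ)
    × (∀ {X} (m : Hom X A) → (f ∘ m) ≈ zeroMor isZ →
         Σ (Hom X K) (λ u → ((k ∘ u) ≈ m) × (∀ u' → (k ∘ u') ≈ m → u' ≈ u)))

  IsDaggerMono : ∀ {K A} → Hom K A → Set e
  IsDaggerMono k = ((k †) ∘ k) ≈ id

  record IsDaggerKernelCategory : Set (o ⊔ ℓ ⊔ e) where
    field
      isDagger : IsDaggerCategory
      zero     : Obj
      isZero   : IsZeroObject zero
      kernel   : ∀ {A B} (f : Hom A B) →
                 Σ Obj (λ K → Σ (Hom K A) (λ k → IsKernel isZero f k × IsDaggerMono k))

record FunctorData {o ℓ e o' ℓ' e'} (D : DagCatData o ℓ e) (E : DagCatData o' ℓ' e')
       : Set (o ⊔ ℓ ⊔ o' ⊔ ℓ') where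
  private
    module D = DagCatData D
    module E = DagCatData E
  field
    F₀ : D.Obj → E.Obj
    F₁ : ∀ {A B} → D.Hom A B → E.Hom (F₀ A) (F₀ B)

record IsDKCMorphism {o ℓ e o' ℓ' e'} {D : DagCatData o ℓ e} {E : DagCatData o' ℓ' e'}
       (KD : IsDaggerKernelCategory D) (KE : IsDaggerKernelCategory E)
       (F : FunctorData D E) : Set (o ⊔ ℓ ⊔ e ⊔ o' ⊔ ℓ' ⊔ e') where
  private
    module D = DagCatData D
    module E = DagCatData E
    module KD = IsDaggerKernelCategory KD
    module KE = IsDaggerKernelCategory KE
  open FunctorData F
  field
    F-resp-≈  : ∀ {A B} {f g : D.Hom A B} → D._≈_ f g → E._≈_ (F₁ f) (F₁ g)
    F-id      : ∀ {A} → E._≈_ (F₁ (D.id {A})) E.id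
    F-∘       : ∀ {A B C} (f : D.Hom A B) (g : D.Hom B C) →
                E._≈_ (F₁ (D._∘_ g f)) (E._∘_ (F₁ g) (F₁ f))
    F-†       : ∀ {A B} (f : D.Hom A B) → E._≈_ (F₁ (D._† f)) (E._† (F₁ f))
    F-zero    : IsZeroObject E (F₀ KD.zero)
    F-kernel  : ∀ {A B K} (f : D.Hom A B) (k : D.Hom K A) →
                IsKernel D KD.isZero f k → IsKernel E KE.isZero (F₁ f) (F₁ k)

module _ {c} (S : FoulisSemigroup c) where
  open FoulisSemigroup S

  KarObj : Set c
  KarObj = Σ Carrier IsSAI

  KarHom : KarObj → KarObj → Set c
  KarHom (s , _) (t , _) = Σ Carrier (λ f → (f · s ≡ f) × (t · f ≡ f))

  Kar : DagCatData c c c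
  Kar = record
    { Obj = KarObj
    ; Hom = KarHom
    ; _≈_ = λ f g → proj₁ f ≡ proj₁ g
    ; id  = λ { {s , (_ , q)} → s , q , q }
    ; _∘_ = λ { {s , _} {t , _} {u , _} (g , g1 , g2) (f , f1 , f2) →
                g · f
              , trans (assoc g f s) (cong (g ·_) f1)
              , trans (sym (assoc u g f)) (cong (_· f) g2) }
    ; _†  = λ { {s , (ps , _)} {t , (pt , _)} (f , f1 , f2) →
                f †
              , trans (cong (λ z → f † · z) (sym pt))
                      (trans (sym (†-anti t f)) (cong _† f2))
              , trans (cong (_· f †) (sym ps))
                      (trans (sym (†-anti f s)) (cong _† f1)) }
    }

module _ {c} {S T : FoulisSemigroup c} (h : FsgHom S T) where
  private
    module S = FoulisSemigroup S
    module T = FoulisSemigroup T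
  open FsgHom h

  KarMap : FunctorData (Kar S) (Kar T)
  KarMap = record
    { F₀ = λ { (s , (p , q)) →
               fun s
             , trans (sym (hom-† s)) (cong fun p)
             , trans (sym (hom-· s s)) (cong fun q) }
    ; F₁ = λ { {s , _} {t , _} (f , f1 , f2) →
               fun f
             , trans (sym (hom-· f s)) (cong fun f1)
             , trans (sym (hom-· t f)) (cong fun f2) }
    }

IdF : ∀ {o ℓ e} (D : DagCatData o ℓ e) → FunctorData D D
IdF D = record { F₀ = λ A → A ; F₁ = λ f → f }

_∘F_ : ∀ {o ℓ e} {D E G : DagCatData o ℓ e} → FunctorData E G → FunctorData D E → FunctorData D G
G ∘F F = record { F₀ = λ A → FunctorData.F₀ G (FunctorData.F₀ F A)
                ; F₁ = λ f → FunctorData.F₁ G (FunctorData.F₁ F f) }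

KarFEq : ∀ {c} (S T : FoulisSemigroup c) → FunctorData (Kar S) (Kar T) → FunctorData (Kar S) (Kar T) → Set c
KarFEq S T F G = (∀ A → proj₁ (FunctorData.F₀ F A) ≡ proj₁ (FunctorData.F₀ G A))
          × (∀ {A B} (f : KarHom S A B) →
               proj₁ (FunctorData.F₁ F {A} {B} f) ≡ proj₁ (FunctorData.F₁ G {A} {B} f))

module Submission where

-- The key notion is a kernel certificate for k : κ → a and f : a → b: the
-- equation f·k = 0 together with an element v inverting k against the
-- projection a·[f] (k·v = a·[f], v·k = κ, κ·v = v).  It is a purely
-- equational condition in S.  We show that in Kar†(S) a morphism k is a kernel
-- of f exactly when such a certificate exists (certificate⇒kernel and
-- kernel⇒certificate).  Then:
--   * a·[f] certifies itself, giving the explicit dagger kernel;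
--   * a homomorphism h : S → T maps certificates to certificates, so the
--     induced functor Kar†(h) preserves kernels;
--   * all remaining functoriality facts hold by the homomorphism laws of h.

open import Defs
open import Level using (Level)
open import Data.Product using (Σ; _×_; _,_; proj₁; proj₂)
open import Relation.Binary.PropositionalEquality
  using (_≡_; refl; sym; trans; cong; cong₂; module ≡-Reasoning)
open ≡-Reasoning

module FoulisFacts {c : Level} (S : FoulisSemigroup c) where
  open FoulisSemigroup S

  []-absorbs : ∀ f x → f · x ≡ 𝟘 → [ f ] · x ≡ x
  []-absorbs f x fx≡0 with foulis⇒ f x fx≡0
  ... | y , x≡[f]y = begin
    [ f ] · x           ≡⟨ cong ([ f ] ·_) x≡[f]y ⟩
    [ f ] · ([ f ] · y) ≡⟨ sym (assoc [ f ] [ f ] y) ⟩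
    ([ f ] · [ f ]) · y ≡⟨ cong (_· y) ([]-idem f) ⟩
    [ f ] · y           ≡⟨ sym x≡[f]y ⟩
    x                   ∎

  annihilates-[] : ∀ f → f · [ f ] ≡ 𝟘
  annihilates-[] f = foulis⇐ f [ f ] (ε , sym (identityʳ [ f ]))

  -- An algebraic witness that k (with source κ) is a kernel of f (with source a):
  -- f kills k, and k is isomorphic to the projection a·[f] via `inverse`.
  record KernelCertificate (a f κ k : Carrier) : Set c where
    field
      annihilates : f · k ≡ 𝟘
      inverse     : Carrier
      k·inverse   : k · inverse ≡ a · [ f ]
      inverse·k   : inverse · k ≡ κ
      κ·inverse   : κ · inverse ≡ inverse

  -- For a self-adjoint idempotent a and f with f·a = f, the element a·[f] is
  -- the projection onto the part of a annihilated by f.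
  module KernelProjection {a : Carrier} (a-sai : IsSAI a) {f : Carrier} (f·a≡f : f · a ≡ f) where
    p : Carrier
    p = a · [ f ]

    f·p≡0 : f · p ≡ 𝟘
    f·p≡0 = begin
      f · (a · [ f ]) ≡⟨ sym (assoc f a [ f ]) ⟩
      (f · a) · [ f ] ≡⟨ cong (_· [ f ]) f·a≡f ⟩
      f · [ f ]       ≡⟨ annihilates-[] f ⟩
      𝟘               ∎

    [f]·p≡p : [ f ] · p ≡ p
    [f]·p≡p = []-absorbs f p f·p≡0

    a·p≡p : a · p ≡ p
    a·p≡p = trans (sym (assoc a a [ f ])) (cong (_· [ f ]) (proj₂ a-sai))

    p-fixes : ∀ m → a · m ≡ m → f · m ≡ 𝟘 → p · m ≡ m
    p-fixes m a·m≡m f·m≡0 = begin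
      (a · [ f ]) · m ≡⟨ assoc a [ f ] m ⟩
      a · ([ f ] · m) ≡⟨ cong (a ·_) ([]-absorbs f m f·m≡0) ⟩
      a · m           ≡⟨ a·m≡m ⟩
      m               ∎

    p-idem : p · p ≡ p
    p-idem = p-fixes p a·p≡p f·p≡0

    -- self-adjointness: p = [f]·a·[f], which is manifestly self-adjoint.
    p-sa : p † ≡ p
    p-sa = begin
      p †                     ≡⟨ cong _† (sym [f]·p≡p) ⟩
      ([ f ] · p) †           ≡⟨ †-anti [ f ] p ⟩
      p † · [ f ] †           ≡⟨ cong₂ _·_ (†-anti a [ f ]) (sym ([]-sa f)) ⟩
      ([ f ] † · a †) · [ f ] ≡⟨ cong₂ (λ x y → (x · y) · [ f ]) (sym ([]-sa f)) (proj₁ a-sai) ⟩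
      ([ f ] · a) · [ f ]     ≡⟨ assoc [ f ] a [ f ] ⟩
      [ f ] · p               ≡⟨ [f]·p≡p ⟩
      p                       ∎

    p-sai : IsSAI p
    p-sai = p-sa , p-idem

    canonicalCertificate : KernelCertificate a f p p
    canonicalCertificate = record
      { annihilates = f·p≡0 ; inverse = p
      ; k·inverse = p-idem ; inverse·k = p-idem ; κ·inverse = p-idem }

module KaroubiEnvelope {c : Level} (S : FoulisSemigroup c) where
  open FoulisSemigroup S
  open FoulisFacts S

  isDaggerCategory : IsDaggerCategory (Kar S)
  isDaggerCategory = record
    { isEquiv   = record { refl = refl ; sym = sym ; trans = trans }
    ; ∘-resp-≈  = cong₂ _·_
    ; assoc     = λ f g h → assoc (proj₁ h) (proj₁ g) (proj₁ f)
    ; identityˡ = λ f → proj₂ (proj₂ f)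
    ; identityʳ = λ f → proj₁ (proj₂ f)
    ; †-resp-≈  = cong _†
    ; †-id      = λ { {_ , s†≡s , _} → s†≡s }
    ; †-∘       = λ f g → †-anti (proj₁ g) (proj₁ f)
    ; †-invol   = λ f → †-invol (proj₁ f)
    }

  zero-carried-isZero : (Z : KarObj S) → proj₁ Z ≡ 𝟘 → IsZeroObject (Kar S) Z
  zero-carried-isZero (z , _) z≡0 (a , _) =
      ((𝟘 , zeroˡ a , zeroʳ z) ,
        λ { (g , _ , z·g≡g) → trans (sym z·g≡g) (trans (cong (_· g) z≡0) (zeroˡ g)) })
    , ((𝟘 , zeroˡ z , zeroʳ a) ,
        λ { (g , g·z≡g , _) → trans (sym g·z≡g) (trans (cong (g ·_) z≡0) (zeroʳ g)) })

  zeroObj : KarObj S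
  zeroObj = 𝟘 , sym ([]-sa ε) , []-idem ε

  isZero : IsZeroObject (Kar S) zeroObj
  isZero = zero-carried-isZero zeroObj refl

  zeroMor≡0 : ∀ X Y → proj₁ (zeroMor (Kar S) {zeroObj} isZero {X} {Y}) ≡ 𝟘
  zeroMor≡0 _ _ = zeroˡ 𝟘

  UniqueFactor : ∀ {X K A} → KarHom S K A → KarHom S X A → Set c
  UniqueFactor {X} {K} k m = Σ (KarHom S X K) (λ u → (proj₁ k · proj₁ u ≡ proj₁ m)
    × (∀ (u' : KarHom S X K) → proj₁ k · proj₁ u' ≡ proj₁ m → proj₁ u' ≡ proj₁ u))

  IsKarKernel : ∀ {A B K} → KarHom S A B → KarHom S K A → Set c
  IsKarKernel {A} {B} {K} f k = IsKernel (Kar S) {zeroObj} isZero {A} {B} {K} f k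

  -- A certificate makes k a kernel: m factors as k·(inverse·m), uniquely
  -- because any factor u satisfies u = κ·u = inverse·k·u.
  certificate⇒kernel : ∀ {A B K} (f : KarHom S A B) (k : KarHom S K A) →
    KernelCertificate (proj₁ A) (proj₁ f) (proj₁ K) (proj₁ k) → IsKarKernel {A} {B} {K} f k
  certificate⇒kernel {a , a-sai} {B} {κ , κ-sai} (f , f·a≡f , _) (k , k·κ≡k , a·k≡k) cert =
    trans annihilates (sym (zeroMor≡0 (κ , κ-sai) B)) ,
    λ {X} m f·m≈0 → factor {X} m (trans f·m≈0 (zeroMor≡0 X B))
    where
    open KernelCertificate cert
    open KernelProjection a-sai f·a≡f

    factor : ∀ {X} (m : KarHom S X (a , a-sai)) → f · proj₁ m ≡ 𝟘 →
      UniqueFactor {X} {κ , κ-sai} {a , a-sai} (k , k·κ≡k , a·k≡k) m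
    factor {x , x-sai} (m , m·x≡m , a·m≡m) f·m≡0 =
        (inverse · m , u·x≡u , κ·u≡u) , k·u≡m , unique
      where
      u·x≡u : (inverse · m) · x ≡ inverse · m
      u·x≡u = trans (assoc inverse m x) (cong (inverse ·_) m·x≡m)

      κ·u≡u : κ · (inverse · m) ≡ inverse · m
      κ·u≡u = trans (sym (assoc κ inverse m)) (cong (_· m) κ·inverse)

      k·u≡m : k · (inverse · m) ≡ m
      k·u≡m = begin
        k · (inverse · m) ≡⟨ sym (assoc k inverse m) ⟩
        (k · inverse) · m ≡⟨ cong (_· m) k·inverse ⟩
        p · m             ≡⟨ p-fixes m a·m≡m f·m≡0 ⟩
        m                 ∎

      unique : ∀ (u' : KarHom S (x , x-sai) (κ , κ-sai)) → k · proj₁ u' ≡ m → proj₁ u' ≡ inverse · m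
      unique (u' , _ , κ·u'≡u') k·u'≡m = begin
        u'                 ≡⟨ sym κ·u'≡u' ⟩
        κ · u'             ≡⟨ cong (_· u') (sym inverse·k) ⟩
        (inverse · k) · u' ≡⟨ assoc inverse k u' ⟩
        inverse · (k · u') ≡⟨ cong (inverse ·_) k·u'≡m ⟩
        inverse · m        ∎

  -- Conversely every kernel carries a certificate: the inverse is the factor of
  -- the projection a·[f] through k, and inverse·k = κ since both it and the
  -- identity of κ factor k through itself.
  kernel⇒certificate : ∀ {A B K} (f : KarHom S A B) (k : KarHom S K A) →
    IsKarKernel {A} {B} {K} f k → KernelCertificate (proj₁ A) (proj₁ f) (proj₁ K) (proj₁ k)
  kernel⇒certificate {a , a-sai} {B} {κ , κ-sai} (f , f·a≡f , _) (k , k·κ≡k , a·k≡k) (f·k≈0 , universal) =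
    record { annihilates = f·k≡0 ; inverse = v ; k·inverse = k·v≡p
           ; inverse·k = v·k≡κ ; κ·inverse = κ·v≡v }
    where
    open KernelProjection a-sai f·a≡f

    f·k≡0 : f · k ≡ 𝟘
    f·k≡0 = trans f·k≈0 (zeroMor≡0 (κ , κ-sai) B)

    projection : KarHom S (p , p-sai) (a , a-sai)
    projection = p , p-idem , a·p≡p

    factorP : UniqueFactor {p , p-sai} {κ , κ-sai} {a , a-sai} (k , k·κ≡k , a·k≡k) projection
    factorP = universal {p , p-sai} projection (trans f·p≡0 (sym (zeroMor≡0 (p , p-sai) B)))

    v : Carrier
    v = proj₁ (proj₁ factorP)

    k·v≡p : k · v ≡ p
    k·v≡p = proj₁ (proj₂ factorP)

    κ·v≡v : κ · v ≡ v
    κ·v≡v = proj₂ (proj₂ (proj₁ factorP))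

    factorK : UniqueFactor {κ , κ-sai} {κ , κ-sai} {a , a-sai} (k , k·κ≡k , a·k≡k) (k , k·κ≡k , a·k≡k)
    factorK = universal {κ , κ-sai} (k , k·κ≡k , a·k≡k) f·k≈0

    k·[v·k]≡k : k · (v · k) ≡ k
    k·[v·k]≡k = begin
      k · (v · k) ≡⟨ sym (assoc k v k) ⟩
      (k · v) · k ≡⟨ cong (_· k) k·v≡p ⟩
      p · k       ≡⟨ p-fixes k a·k≡k f·k≡0 ⟩
      k           ∎

    v·k : KarHom S (κ , κ-sai) (κ , κ-sai)
    v·k = v · k
        , trans (assoc v k κ) (cong (v ·_) k·κ≡k)
        , trans (sym (assoc κ v k)) (cong (_· k) κ·v≡v)

    v·k≡κ : v · k ≡ κ
    v·k≡κ = trans (proj₂ (proj₂ factorK) v·k k·[v·k]≡k)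
                  (sym (proj₂ (proj₂ factorK) (κ , proj₂ κ-sai , proj₂ κ-sai) k·κ≡k))

  canonicalKernel : ∀ {A B : KarObj S} (f : KarHom S A B) →
    Σ (IsSAI (proj₁ A · [ proj₁ f ])) (λ p-sai →
      Σ (KarHom S (proj₁ A · [ proj₁ f ] , p-sai) A) (λ k →
        (proj₁ k ≡ proj₁ A · [ proj₁ f ])
        × IsKarKernel {A} {B} {proj₁ A · [ proj₁ f ] , p-sai} f k
        × IsDaggerMono (Kar S) {proj₁ A · [ proj₁ f ] , p-sai} {A} k))
  canonicalKernel {a , a-sai} {B} (f , f·a≡f , b·f≡f) =
      p-sai , projection , refl
    , certificate⇒kernel {a , a-sai} {B} {p , p-sai} (f , f·a≡f , b·f≡f) projection canonicalCertificate
    , trans (cong (_· p) p-sa) p-idem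
    where
    open KernelProjection a-sai f·a≡f
    projection : KarHom S (p , p-sai) (a , a-sai)
    projection = p , p-idem , a·p≡p

  isDaggerKernelCategory : IsDaggerKernelCategory (Kar S)
  isDaggerKernelCategory = record
    { isDagger = isDaggerCategory
    ; zero     = zeroObj
    ; isZero   = isZero
    ; kernel   = λ {A} {B} f → let (p-sai , k , _ , isKernel , isDaggerMono) = canonicalKernel {A} {B} f
                               in (proj₁ A · [ proj₁ f ] , p-sai) , k , isKernel , isDaggerMono
    }

module KaroubiFunctor {c : Level} {S T : FoulisSemigroup c} (h : FsgHom S T) where
  private
    module S = FoulisSemigroup S
    module T = FoulisSemigroup T
    module KS = KaroubiEnvelope S
    module KT = KaroubiEnvelope T
  open FsgHom h
  open FunctorData (KarMap h)

  h-zero : fun S.𝟘 ≡ T.𝟘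
  h-zero = trans (hom-[] S.ε) (cong T.[_] hom-ε)

  h-eq : ∀ {x y z} → x S.· y ≡ z → fun x T.· fun y ≡ fun z
  h-eq {x} {y} x·y≡z = trans (sym (hom-· x y)) (cong fun x·y≡z)

  -- Kernel certificates are equational, hence preserved by homomorphisms.
  mapCertificate : ∀ {a f κ k} → FoulisFacts.KernelCertificate S a f κ k →
    FoulisFacts.KernelCertificate T (fun a) (fun f) (fun κ) (fun k)
  mapCertificate {a} {f} cert = record
    { annihilates = trans (h-eq annihilates) h-zero
    ; inverse     = fun inverse
    ; k·inverse   = trans (h-eq k·inverse) (trans (hom-· a S.[ f ]) (cong (fun a T.·_) (hom-[] f)))
    ; inverse·k   = h-eq inverse·k
    ; κ·inverse   = h-eq κ·inverse
    }
    where open FoulisFacts.KernelCertificate cert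

  preservesKernels : ∀ {A B K} (f : KarHom S A B) (k : KarHom S K A) →
    KS.IsKarKernel {A} {B} {K} f k → KT.IsKarKernel {F₀ A} {F₀ B} {F₀ K} (F₁ {A} {B} f) (F₁ {K} {A} k)
  preservesKernels {A} {B} {K} f k isKernel =
    KT.certificate⇒kernel {F₀ A} {F₀ B} {F₀ K} (F₁ {A} {B} f) (F₁ {K} {A} k)
      (mapCertificate (KS.kernel⇒certificate {A} {B} {K} f k isKernel))

  isDKCMorphism : IsDKCMorphism KS.isDaggerKernelCategory KT.isDaggerKernelCategory (KarMap h)
  isDKCMorphism = record
    { F-resp-≈ = cong fun
    ; F-id     = refl
    ; F-∘      = λ f g → hom-· (proj₁ g) (proj₁ f)
    ; F-†      = λ f → hom-† (proj₁ f)
    ; F-zero   = KT.zero-carried-isZero (F₀ KS.zeroObj) h-zero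
    ; F-kernel = λ {A} {B} {K} → preservesKernels {A} {B} {K}
    }

theorem4p4 : ∀ {c : Level} →
    Σ ((S : FoulisSemigroup c) → IsDaggerKernelCategory (Kar S)) (λ K →
      -- explicit dagger kernels: the kernel of f : s → t is s·[f] : (s·[f]) → s
      ((S : FoulisSemigroup c) → ∀ {s t : KarObj S} (f : KarHom S s t) →
        Σ (FoulisSemigroup.IsSAI S (FoulisSemigroup._·_ S (proj₁ s) (FoulisSemigroup.[_] S (proj₁ f)))) (λ p →
          Σ (KarHom S (FoulisSemigroup._·_ S (proj₁ s) (FoulisSemigroup.[_] S (proj₁ f)) , p) s) (λ k →
            (proj₁ k ≡ FoulisSemigroup._·_ S (proj₁ s) (FoulisSemigroup.[_] S (proj₁ f)))
            × IsKernel (Kar S) {IsDaggerKernelCategory.zero (K S)} (IsDaggerKernelCategory.isZero (K S)) {s} {t} {FoulisSemigroup._·_ S (proj₁ s) (FoulisSemigroup.[_] S (proj₁ f)) , p} f k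
            × IsDaggerMono (Kar S) {FoulisSemigroup._·_ S (proj₁ s) (FoulisSemigroup.[_] S (proj₁ f)) , p} {s} k)))
      -- functoriality Fsg → DKC
      × (∀ {S T : FoulisSemigroup c} (h : FsgHom S T) → IsDKCMorphism (K S) (K T) (KarMap h))
      × (∀ (S : FoulisSemigroup c) → KarFEq S S (KarMap (idFsg S)) (IdF (Kar S)))
      × (∀ {S T U : FoulisSemigroup c} (g : FsgHom T U) (h : FsgHom S T) →
           KarFEq S U (KarMap (g ∘Fsg h)) (KarMap g ∘F KarMap h)))
theorem4p4 =
    KaroubiEnvelope.isDaggerKernelCategory
  , (λ S {s} {t} → KaroubiEnvelope.canonicalKernel S {s} {t})
  , KaroubiFunctor.isDKCMorphism
  , (λ S → (λ A → refl) , (λ f → refl))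
  , (λ g h → (λ A → refl) , (λ f → refl))
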